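{- For any prime $p>3$, $$\sum_{k=1}^{(p-1)/2}\frac{(-3)^k}{k}\equiv-2q_p(2)\pmod{p},$$ where $q_p(2)=(2^{p-1}-1)/p$.
   Context: $q_p(2)=(2^{p-1}-1)/p$ is the Fermat quotient of $2$ modulo $p$. For rational numbers $a,b$ with denominators prime to $p$, $a\equiv b\pmod p$ means $(a-b)/p$ is a rational number with denominator prime to $p$. -}

module Defs where

open import Data.Nat as ℕ using (ℕ; zero; suc; NonZero; _∸_)
open import Data.Nat.Coprimality using (Coprime)
open import Data.Integer as ℤ using (ℤ; +_)
open import Data.Rational as ℚ using (ℚ; ↧ₙ_)

Σ₁ : ℕ → (ℕ → ℚ) → ℚ
Σ₁ zero    f = ℚ.0ℚ
Σ₁ (suc m) f = Σ₁ m f ℚ.+ f (suc m)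

_≡_[modℚ_] : ℚ → ℚ → (p : ℕ) → .{{NonZero p}} → Set
a ≡ b [modℚ p ] = Coprime p (↧ₙ ((a ℚ.- b) ℚ.* ((+ 1) ℚ./ p)))

summand : ℕ → ℚ
summand zero    = ℚ.0ℚ
summand (suc i) = (ℤ.- (+ 3)) ℤ.^ (suc i) ℚ./ suc i

fermatQuotient₂ : (p : ℕ) → .{{NonZero p}} → ℚ
fermatQuotient₂ p = (+ (2 ℕ.^ (p ∸ 1)) ℤ.- + 1) ℚ./ p

module Submission where

-- Let p = 2m + 1 be a prime with p > 3.  The proof follows the classical
-- route through the binomial expansion of (1 + √−3)^p.
--
-- * Absorption k·C(p,k) = p·C(p−1,k−1) together with C(p−1,2k−1) ≡ −1 (mod p)
--   splits every term:  (−3)^k/k = −2·C(p,2k)(−3)^k/p + p·y_k  with y_k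
--   p-integral.  Summing over 1 ≤ k ≤ m, the first parts add up to
--   −2·(a_p − 1)/p, where a_n = Σ_j C(n,2j)(−3)^j is the rational part of
--   (1 + √−3)^n.  Hence the sum is ≡ −2·(a_p − 1)/p (mod p) for every odd
--   prime p.
-- * a_n is the binomial transform of the real parts 1, 0, −3, 0, 9, … of the
--   powers of √−3; Pascal's rule gives the recurrence of multiplication by
--   1 + √−3, whose cube is −8.  So a_{n+6} = 64·a_n, and since a prime p > 3
--   is ≡ ±1 (mod 6), a_p = 2^(p−1).

module Primes where

  open import Data.Nat
  open import Data.Nat.Properties
  open import Data.Nat.DivMod using (m≡m%n+[m/n]*n; m%n<n; m*n/n≡m)
  open import Data.Nat.Divisibility using (_∣_; divides; ∣⇒≤)
  open import Data.Nat.Primality using (Prime; prime⇒¬composite; composite-≢; prime⇒nonZero)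
  open import Data.Product using (Σ; _,_)
  open import Data.Sum using (_⊎_; inj₁; inj₂)
  open import Data.Empty using (⊥-elim)
  open import Relation.Nullary using (¬_)
  open import Relation.Binary.PropositionalEquality

  -- Doubling by recursion, so that parity patterns compute.
  double : ℕ → ℕ
  double zero    = zero
  double (suc m) = suc (suc (double m))

  double≡*2 : ∀ m → double m ≡ m * 2
  double≡*2 zero    = refl
  double≡*2 (suc m) = cong (λ n → suc (suc n)) (double≡*2 m)

  half-double : ∀ m → double m / 2 ≡ m
  half-double m = trans (cong (_/ 2) (double≡*2 m)) (m*n/n≡m m 2)

  n≤double : ∀ n → n ≤ double n
  n≤double n = subst (n ≤_) (sym (double≡*2 n)) (m≤m*n n 2)

  double-< : ∀ {i m} → i < m → suc (double i) < double m
  double-< {zero}  {suc m} _         = s≤s (s≤s z≤n)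
  double-< {suc i} {suc m} (s≤s i<m) = s≤s (s≤s (double-< i<m))

  prime-no-divisor : ∀ {p} → Prime p → ∀ d → .{{NonTrivial d}} → d < p → ¬ d ∣ p
  prime-no-divisor pr d d<p d∣p = prime⇒¬composite pr (composite-≢ d (<⇒≢ d<p) d∣p)
    where instance _ = prime⇒nonZero pr

  prime∤ : ∀ {p k} → Prime p → 0 < k → k < p → ¬ p ∣ k
  prime∤ {k = suc k} _ _ k<p p∣k = <⇒≱ k<p (∣⇒≤ p∣k)

  prime-odd : ∀ {p} → Prime p → 2 < p → Σ ℕ λ m → p ≡ suc (double m)
  prime-odd {p} pr 2<p = classify (p % 2) (m%n<n p 2) (m≡m%n+[m/n]*n p 2)
    where
    classify : ∀ r → r < 2 → p ≡ r + p / 2 * 2 → Σ ℕ λ m → p ≡ suc (double m)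
    classify 0 _ eq = ⊥-elim (prime-no-divisor pr 2 2<p (divides (p / 2) eq))
    classify 1 _ eq = p / 2 , trans eq (cong suc (sym (double≡*2 (p / 2))))
    classify (suc (suc r)) (s≤s (s≤s ())) _

  prime-mod-6 : ∀ {p} → Prime p → 3 < p → Σ ℕ λ t → p ≡ t * 6 + 1 ⊎ p ≡ t * 6 + 5
  prime-mod-6 {p} pr 3<p = classify (p % 6) (p / 6) (m%n<n p 6) (m≡m%n+[m/n]*n p 6)
    where
    2<p : 2 < p
    2<p = <-trans (n<1+n 2) 3<p
    classify : ∀ r t → r < 6 → p ≡ r + t * 6 → Σ ℕ λ t → p ≡ t * 6 + 1 ⊎ p ≡ t * 6 + 5
    classify 0 t _ eq = ⊥-elim (prime-no-divisor pr 2 2<p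
      (divides (t * 3) (trans eq (sym (*-assoc t 3 2)))))
    classify 1 t _ eq = t , inj₁ (trans eq (+-comm 1 (t * 6)))
    classify 2 t _ eq = ⊥-elim (prime-no-divisor pr 2 2<p
      (divides (1 + t * 3) (trans eq (cong (2 +_) (sym (*-assoc t 3 2))))))
    classify 3 t _ eq = ⊥-elim (prime-no-divisor pr 3 3<p
      (divides (1 + t * 2) (trans eq (cong (3 +_) (sym (*-assoc t 2 3))))))
    classify 4 t _ eq = ⊥-elim (prime-no-divisor pr 2 2<p
      (divides (2 + t * 3) (trans eq (cong (4 +_) (sym (*-assoc t 3 2))))))
    classify 5 t _ eq = t , inj₂ (trans eq (+-comm 5 (t * 6)))
    classify (suc (suc (suc (suc (suc (suc r)))))) t (s≤s (s≤s (s≤s (s≤s (s≤s (s≤s ())))))) _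

module BinomialsModPrime where

  open import Data.Nat
  open import Data.Nat.Properties
  open import Data.Nat.Combinatorics using (_C_; nC1≡n; nCk+nC[k+1]≡[n+1]C[k+1])
  open import Data.Nat.Divisibility using (_∣_; divides; ∣-refl; ∣m∣n⇒∣m+n; ∣m+n∣m⇒∣n)
  open import Data.Nat.Primality using (Prime; euclidsLemma)
  open import Data.Nat.Tactic.RingSolver using (solve-∀)
  open import Data.Sum using (inj₁; inj₂)
  open import Data.Empty using (⊥-elim)
  open import Relation.Binary.PropositionalEquality
  open Primes using (double; prime∤)

  pascal : ∀ n k → n C k + n C suc k ≡ suc n C suc k
  pascal = nCk+nC[k+1]≡[n+1]C[k+1]

  absorption : ∀ n k → suc k * (suc n C suc k) ≡ suc n * (n C k)
  absorption zero    zero    = refl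
  absorption zero    (suc k) = *-zeroʳ (suc (suc k))
  absorption (suc n) zero    = begin
    1 * (suc (suc n) C 1)  ≡⟨ *-identityˡ _ ⟩
    suc (suc n) C 1        ≡⟨ nC1≡n (suc (suc n)) ⟩
    suc (suc n)            ≡⟨ *-identityʳ (suc (suc n)) ⟨
    suc (suc n) * 1        ∎
    where open ≡-Reasoning
  absorption (suc n) (suc k) = begin
    suc (suc k) * (suc (suc n) C suc (suc k))   ≡⟨ cong (suc (suc k) *_) (pascal (suc n) (suc k)) ⟨
    suc (suc k) * (X + Y)                       ≡⟨ *-distribˡ-+ (suc (suc k)) X Y ⟩
    (X + suc k * X) + suc (suc k) * Y           ≡⟨ +-assoc X (suc k * X) (suc (suc k) * Y) ⟩
    X + (suc k * X + suc (suc k) * Y)           ≡⟨ cong (X +_) (cong₂ _+_ (absorption n k) (absorption n (suc k))) ⟩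
    X + (suc n * (n C k) + suc n * (n C suc k)) ≡⟨ cong (X +_) (*-distribˡ-+ (suc n) (n C k) (n C suc k)) ⟨
    X + suc n * (n C k + n C suc k)             ≡⟨ cong (λ z → X + suc n * z) (pascal n k) ⟩
    X + suc n * X                               ∎
    where
    open ≡-Reasoning
    X = suc n C suc k
    Y = suc n C suc (suc k)

  -- A prime p divides C(p,k) for 0 < k < p: it divides k·C(p,k) = p·C(p−1,k−1)
  -- but not k.
  prime∣binomial : ∀ {n} → Prime (suc n) → ∀ k → suc k < suc n → suc n ∣ suc n C suc k
  prime∣binomial {n} pr k k<p
    with euclidsLemma (suc k) (suc n C suc k) pr
           (divides (n C k) (trans (absorption n k) (*-comm (suc n) (n C k))))
  ... | inj₁ p∣k = ⊥-elim (prime∤ pr (s≤s z≤n) k<p p∣k)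
  ... | inj₂ p∣C = p∣C

  prime∣adjacent : ∀ {n} → Prime (suc n) → ∀ k → suc k < suc n → suc n ∣ n C k + n C suc k
  prime∣adjacent {n} pr k k<p = subst (suc n ∣_) (sym (pascal n k)) (prime∣binomial pr k k<p)

  -- Alternating along the row p − 1: C(p−1, 2i+1) ≡ −1 (mod p).
  prime∣binomial-odd+1 : ∀ {n} → Prime (suc n) → ∀ i → suc (double i) < suc n →
                         suc n ∣ n C suc (double i) + 1
  prime∣binomial-odd+1 {n} pr zero _ = subst (suc n ∣_) eq ∣-refl
    where
    eq : suc n ≡ n C 1 + 1
    eq = trans (+-comm 1 n) (cong (_+ 1) (sym (nC1≡n n)))
  prime∣binomial-odd+1 {n} pr (suc i) j+2<p =
    ∣m+n∣m⇒∣n (subst (suc n ∣_) (shuffle c₀ c₁ c₂)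
                 (∣m∣n⇒∣m+n (prime∣adjacent pr (suc j) j+2<p) previous))
              (prime∣adjacent pr j j+1<p)
    where
    j = suc (double i)
    c₀ = n C j
    c₁ = n C suc j
    c₂ = n C suc (suc j)
    j+1<p : suc j < suc n
    j+1<p = <-trans (n<1+n (suc j)) j+2<p
    previous : suc n ∣ c₀ + 1
    previous = prime∣binomial-odd+1 pr i (<-trans (n<1+n j) j+1<p)
    shuffle : ∀ a b c → (b + c) + (a + 1) ≡ (a + b) + (c + 1)
    shuffle = solve-∀

module BinomialTransform where

  open import Data.Nat as ℕ using (ℕ; zero; suc)
  import Data.Nat.Properties as ℕ
  open import Data.Nat.Combinatorics using (_C_; nCk+nC[k+1]≡[n+1]C[k+1]; k>n⇒nCk≡0)
  open import Data.Integer using (ℤ; +_; _+_; _*_)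
  open import Data.Integer.Properties
  open import Data.Integer.Tactic.RingSolver using (solve-∀)
  open import Function using (_∘_)
  open import Relation.Binary.PropositionalEquality
  open ≡-Reasoning
  open Primes using (double)

  ∑< : ℕ → (ℕ → ℤ) → ℤ
  ∑< zero    f = + 0
  ∑< (suc n) f = ∑< n f + f n

  ∑<-cong : ∀ n {f g : ℕ → ℤ} → (∀ j → f j ≡ g j) → ∑< n f ≡ ∑< n g
  ∑<-cong zero    _  = refl
  ∑<-cong (suc n) eq = cong₂ _+_ (∑<-cong n eq) (eq n)

  ∑<-+ : ∀ n f g → ∑< n (λ j → f j + g j) ≡ ∑< n f + ∑< n g
  ∑<-+ zero    f g = refl
  ∑<-+ (suc n) f g = trans (cong (_+ (f n + g n)) (∑<-+ n f g)) (swap (∑< n f) (∑< n g) (f n) (g n))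
    where
    swap : ∀ a b c d → (a + b) + (c + d) ≡ (a + c) + (b + d)
    swap = solve-∀

  ∑<-*ˡ : ∀ n c f → ∑< n (λ j → c * f j) ≡ c * ∑< n f
  ∑<-*ˡ zero    c f = sym (*-zeroʳ c)
  ∑<-*ˡ (suc n) c f =
    trans (cong (_+ c * f n) (∑<-*ˡ n c f)) (sym (*-distribˡ-+ c (∑< n f) (f n)))

  ∑<-head : ∀ n f → ∑< (suc n) f ≡ f 0 + ∑< n (f ∘ suc)
  ∑<-head zero    f = trans (+-identityˡ (f 0)) (sym (+-identityʳ (f 0)))
  ∑<-head (suc n) f =
    trans (cong (_+ f (suc n)) (∑<-head n f)) (+-assoc (f 0) (∑< n (f ∘ suc)) (f (suc n)))

  ∑<-pairs : ∀ m f → ∑< (double m) f ≡ ∑< m (λ k → f (double k) + f (suc (double k)))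
  ∑<-pairs zero    f = refl
  ∑<-pairs (suc m) f =
    trans (cong (λ s → s + f (double m) + f (suc (double m))) (∑<-pairs m f))
          (+-assoc (∑< m (λ k → f (double k) + f (suc (double k)))) (f (double m)) (f (suc (double m))))

  binomialTransform : (ℕ → ℤ) → ℕ → ℤ
  binomialTransform w n = ∑< (suc n) (λ j → + (n C j) * w j)

  binomialTransform-scale : ∀ c w n → binomialTransform (λ j → c * w j) n ≡ c * binomialTransform w n
  binomialTransform-scale c w n =
    trans (∑<-cong (suc n) (λ j → x∙yz≈y∙xz (+ (n C j)) c (w j))) (∑<-*ˡ (suc n) c (λ j → + (n C j) * w j))
    where
    x∙yz≈y∙xz : ∀ x y z → x * (y * z) ≡ y * (x * z)
    x∙yz≈y∙xz = solve-∀

  binomialTransform-suc : ∀ w n →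
    binomialTransform w (suc n) ≡ binomialTransform w n + binomialTransform (w ∘ suc) n
  binomialTransform-suc w n = begin
    ∑< (suc (suc n)) (term (suc n))
      ≡⟨ ∑<-head (suc n) (term (suc n)) ⟩
    w₀ + ∑< (suc n) (term (suc n) ∘ suc)
      ≡⟨ cong (λ s → w₀ + s) (trans (∑<-cong (suc n) pascal-term) (∑<-+ (suc n) shifted (term n ∘ suc))) ⟩
    w₀ + (∑< (suc n) shifted + ∑< (suc n) (term n ∘ suc))
      ≡⟨ rotate w₀ (∑< (suc n) shifted) (∑< (suc n) (term n ∘ suc)) ⟩
    (w₀ + ∑< (suc n) (term n ∘ suc)) + ∑< (suc n) shifted
      ≡⟨ cong (_+ ∑< (suc n) shifted) (∑<-head (suc n) (term n)) ⟨
    ∑< (suc (suc n)) (term n) + ∑< (suc n) shifted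
      ≡⟨ cong (_+ ∑< (suc n) shifted) top-vanishes ⟩
    binomialTransform w n + binomialTransform (w ∘ suc) n ∎
    where
    term : ℕ → ℕ → ℤ
    term m j = + (m C j) * w j
    shifted : ℕ → ℤ
    shifted j = + (n C j) * w (suc j)
    w₀ : ℤ
    w₀ = + 1 * w 0
    pascal-term : ∀ j → term (suc n) (suc j) ≡ shifted j + term n (suc j)
    pascal-term j = begin
      + (suc n C suc j) * w (suc j)                  ≡⟨ cong (λ c → + c * w (suc j)) (nCk+nC[k+1]≡[n+1]C[k+1] n j) ⟨
      + (n C j ℕ.+ n C suc j) * w (suc j)            ≡⟨ cong (_* w (suc j)) (pos-+ (n C j) (n C suc j)) ⟩
      (+ (n C j) + + (n C suc j)) * w (suc j)        ≡⟨ *-distribʳ-+ (w (suc j)) (+ (n C j)) (+ (n C suc j)) ⟩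
      shifted j + term n (suc j)                     ∎
    rotate : ∀ a b c → a + (b + c) ≡ (a + c) + b
    rotate = solve-∀
    top-vanishes : ∑< (suc (suc n)) (term n) ≡ binomialTransform w n
    top-vanishes = begin
      binomialTransform w n + + (n C suc n) * w (suc n)
        ≡⟨ cong (λ c → binomialTransform w n + + c * w (suc n)) (k>n⇒nCk≡0 (ℕ.n<1+n n)) ⟩
      binomialTransform w n + + 0 * w (suc n)
        ≡⟨ +-identityʳ (binomialTransform w n) ⟩
      binomialTransform w n ∎

-- a n is the rational part of (1 + √−3)^n, i.e. Σ_j C(n,2j)(−3)^j.
module PowersOfOnePlusRootMinusThree where

  open import Data.Nat as ℕ using (ℕ; zero; suc; _∸_; _<_; s≤s; z≤n)
  import Data.Nat.Properties as ℕ
  open import Data.Nat.Combinatorics using (_C_)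
  open import Data.Nat.Primality using (Prime)
  open import Data.Integer using (ℤ; +_; -_; _+_; _*_; _^_)
  open import Data.Integer.Properties
  open import Data.Integer.Tactic.RingSolver using (solve-∀)
  open import Data.Product using (_×_; _,_; proj₁)
  open import Data.Sum using (inj₁; inj₂)
  open import Function using (_∘_)
  open import Relation.Binary.PropositionalEquality
  open ≡-Reasoning
  open Primes using (double; prime-mod-6)
  open BinomialTransform

  -- Real parts of the powers of √−3:  1, 0, −3, 0, 9, 0, …
  re : ℕ → ℤ
  re 0               = + 1
  re 1               = + 0
  re (suc (suc j))   = - + 3 * re j

  re-even : ∀ k → re (double k) ≡ (- + 3) ^ k
  re-even zero    = refl
  re-even (suc k) = cong (- + 3 *_) (re-even k)

  re-odd : ∀ k → re (suc (double k)) ≡ + 0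
  re-odd zero    = refl
  re-odd (suc k) = cong (- + 3 *_) (re-odd k)

  -- (1 + √−3)^n = a n + (b n / −3)·√−3.
  a b : ℕ → ℤ
  a = binomialTransform re
  b = binomialTransform (re ∘ suc)

  -- Multiplication by 1 + √−3 in these coordinates.
  step : ℤ × ℤ → ℤ × ℤ
  step (x , y) = x + y , y + - + 3 * x

  ab-suc : ∀ n → (a (suc n) , b (suc n)) ≡ step (a n , b n)
  ab-suc n = cong₂ _,_ (binomialTransform-suc re n)
    (trans (binomialTransform-suc (re ∘ suc) n) (cong (λ s → b n + s) (binomialTransform-scale (- + 3) re n)))

  -- (1 + √−3)^3 = −8.
  step³ : ∀ x y → step (step (step (x , y))) ≡ (- + 8 * x , - + 8 * y)
  step³ x y = cong₂ _,_ (first x y) (second x y)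
    where
    first : ∀ x y → (x + y + (y + - + 3 * x)) + (y + - + 3 * x + - + 3 * (x + y))
                    ≡ - + 8 * x
    first = solve-∀
    second : ∀ x y → y + - + 3 * x + - + 3 * (x + y) + - + 3 * (x + y + (y + - + 3 * x))
                     ≡ - + 8 * y
    second = solve-∀

  a-period-3 : ∀ n → a (3 ℕ.+ n) ≡ - + 8 * a n
  a-period-3 n = cong proj₁ (begin
    (a (3 ℕ.+ n) , b (3 ℕ.+ n))          ≡⟨ ab-suc (2 ℕ.+ n) ⟩
    step (a (2 ℕ.+ n) , b (2 ℕ.+ n))     ≡⟨ cong step (ab-suc (suc n)) ⟩
    step (step (a (suc n) , b (suc n)))  ≡⟨ cong (step ∘ step) (ab-suc n) ⟩
    step (step (step (a n , b n)))       ≡⟨ step³ (a n) (b n) ⟩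
    (- + 8 * a n , - + 8 * b n)          ∎)

  -- (1 + √−3)^6 = 64, so a_{6t + r} = 64^t · a_r.
  a-periodic : ∀ t r → a (t ℕ.* 6 ℕ.+ r) ≡ + (64 ℕ.^ t) * a r
  a-periodic zero    r = sym (*-identityˡ (a r))
  a-periodic (suc t) r = begin
    a (3 ℕ.+ (3 ℕ.+ n))            ≡⟨ a-period-3 (3 ℕ.+ n) ⟩
    - + 8 * a (3 ℕ.+ n)            ≡⟨ cong (- + 8 *_) (a-period-3 n) ⟩
    - + 8 * (- + 8 * a n)          ≡⟨ *-assoc (- + 8) (- + 8) (a n) ⟨
    + 64 * a n                     ≡⟨ cong (+ 64 *_) (a-periodic t r) ⟩
    + 64 * (+ (64 ℕ.^ t) * a r)    ≡⟨ *-assoc (+ 64) (+ (64 ℕ.^ t)) (a r) ⟨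
    + 64 * + (64 ℕ.^ t) * a r      ≡⟨ cong (_* a r) (pos-* 64 (64 ℕ.^ t)) ⟨
    + (64 ℕ.^ suc t) * a r         ∎
    where n = t ℕ.* 6 ℕ.+ r

  a-residue-class : ∀ t r → 0 < r → a r ≡ + (2 ℕ.^ (r ∸ 1)) →
                    a (t ℕ.* 6 ℕ.+ r) ≡ + (2 ℕ.^ (t ℕ.* 6 ℕ.+ r ∸ 1))
  a-residue-class t r 0<r a-r = begin
    a (t ℕ.* 6 ℕ.+ r)                         ≡⟨ a-periodic t r ⟩
    + (64 ℕ.^ t) * a r                        ≡⟨ cong (+ (64 ℕ.^ t) *_) a-r ⟩
    + (64 ℕ.^ t) * + (2 ℕ.^ (r ∸ 1))          ≡⟨ pos-* (64 ℕ.^ t) (2 ℕ.^ (r ∸ 1)) ⟨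
    + (64 ℕ.^ t ℕ.* 2 ℕ.^ (r ∸ 1))            ≡⟨ cong (λ x → + (x ℕ.* 2 ℕ.^ (r ∸ 1))) (ℕ.^-*-assoc 2 6 t) ⟩
    + (2 ℕ.^ (6 ℕ.* t) ℕ.* 2 ℕ.^ (r ∸ 1))     ≡⟨ cong (λ e → + (2 ℕ.^ e ℕ.* 2 ℕ.^ (r ∸ 1))) (ℕ.*-comm 6 t) ⟩
    + (2 ℕ.^ (t ℕ.* 6) ℕ.* 2 ℕ.^ (r ∸ 1))     ≡⟨ cong +_ (ℕ.^-distribˡ-+-* 2 (t ℕ.* 6) (r ∸ 1)) ⟨
    + (2 ℕ.^ (t ℕ.* 6 ℕ.+ (r ∸ 1)))           ≡⟨ cong (λ e → + (2 ℕ.^ e)) (ℕ.+-∸-assoc (t ℕ.* 6) 0<r) ⟨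
    + (2 ℕ.^ (t ℕ.* 6 ℕ.+ r ∸ 1))             ∎

  -- For a prime p > 3:  a_p = 2^(p−1), read off from a_1 = 1 and a_5 = 16.
  a-prime : ∀ {p} → Prime p → 3 < p → a p ≡ + (2 ℕ.^ (p ∸ 1))
  a-prime {p} pr 3<p with prime-mod-6 pr 3<p
  ... | t , inj₁ refl = a-residue-class t 1 (s≤s z≤n) refl
  ... | t , inj₂ refl = a-residue-class t 5 (s≤s z≤n) refl

  -- For odd n = 2m + 1 only even j contribute:  a_n = 1 + Σ_{k=1}^{m} C(n,2k)(−3)^k.
  a-odd : ∀ m → a (suc (double m)) ≡ + 1 + ∑< m (λ k → + (suc (double m) C double (suc k)) * (- + 3) ^ suc k)
  a-odd m = begin
    ∑< (double (suc m)) (λ j → + (n C j) * re j)             ≡⟨ ∑<-pairs (suc m) _ ⟩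
    ∑< (suc m) (λ k → + (n C double k) * re (double k) + + (n C suc (double k)) * re (suc (double k)))
                                                             ≡⟨ ∑<-cong (suc m) even-term ⟩
    ∑< (suc m) (λ k → + (n C double k) * (- + 3) ^ k)        ≡⟨ ∑<-head m _ ⟩
    + 1 * + 1 + ∑< m (λ k → + (n C double (suc k)) * (- + 3) ^ suc k) ∎
    where
    n = suc (double m)
    even-term : ∀ k → + (n C double k) * re (double k) + + (n C suc (double k)) * re (suc (double k))
                      ≡ + (n C double k) * (- + 3) ^ k
    even-term k = begin
      + (n C double k) * re (double k) + + (n C suc (double k)) * re (suc (double k))
        ≡⟨ cong₂ (λ x y → + (n C double k) * x + + (n C suc (double k)) * y) (re-even k) (re-odd k) ⟩
      + (n C double k) * (- + 3) ^ k + + (n C suc (double k)) * + 0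
        ≡⟨ cong (λ s → + (n C double k) * (- + 3) ^ k + s) (*-zeroʳ (+ (n C suc (double k)))) ⟩
      + (n C double k) * (- + 3) ^ k + + 0
        ≡⟨ +-identityʳ _ ⟩
      + (n C double k) * (- + 3) ^ k ∎

module Fractions where

  open import Defs using (Σ₁; _≡_[modℚ_])
  open import Data.Nat as ℕ using (ℕ; zero; suc; NonZero; _<_)
  import Data.Nat.Properties as ℕ
  open import Data.Nat.Divisibility using (_∣_; ∣-trans; m∣m*n; ∣1⇒≡1)
  open import Data.Nat.Primality using (Prime; euclidsLemma; prime⇒irreducible; prime⇒nonTrivial)
  open import Data.Nat.Coprimality using (Coprime)
  open import Data.Nat.GCD using (gcd)
  open import Data.Integer as ℤ using (ℤ; +_)
  import Data.Integer.Properties as ℤ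
  open import Data.Integer.Tactic.RingSolver using (solve-∀)
  open import Data.Rational as ℚ using (ℚ; _/_; ↧ₙ_)
  open import Data.Rational.Properties
  open import Data.Rational.Unnormalised using (mkℚᵘ; *≡*)
  import Data.Rational.Unnormalised.Properties as ℚᵘ
  open import Data.Rational.Solver using (module +-*-Solver)
  open import Data.Product using (Σ; _×_; _,_)
  open import Data.Sum using (inj₁; inj₂)
  open import Data.Empty using (⊥-elim)
  open import Relation.Nullary using (¬_)
  open import Relation.Binary.PropositionalEquality
  open BinomialTransform using (∑<)

  /-≡ : ∀ i j n m .{{_ : NonZero n}} .{{_ : NonZero m}} → i ℤ.* + m ≡ j ℤ.* + n → i / n ≡ j / m
  /-≡ i j (suc n) (suc m) eq = fromℚᵘ-cong {mkℚᵘ i n} {mkℚᵘ j m} (*≡* eq)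

  /-+-/ : ∀ i j n m .{{_ : NonZero n}} .{{_ : NonZero m}} →
          (i / n) ℚ.+ (j / m) ≡ ((i ℤ.* + m ℤ.+ j ℤ.* + n) / (n ℕ.* m)) {{ℕ.m*n≢0 n m}}
  /-+-/ i j (suc n) (suc m) = trans (sym (fromℚᵘ-toℚᵘ _))
    (fromℚᵘ-cong (ℚᵘ.≃-trans (toℚᵘ-homo-+ (i / suc n) (j / suc m))
                             (ℚᵘ.+-cong (toℚᵘ-fromℚᵘ (mkℚᵘ i n)) (toℚᵘ-fromℚᵘ (mkℚᵘ j m)))))

  /-*-/ : ∀ i j n m .{{_ : NonZero n}} .{{_ : NonZero m}} →
          (i / n) ℚ.* (j / m) ≡ ((i ℤ.* j) / (n ℕ.* m)) {{ℕ.m*n≢0 n m}}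
  /-*-/ i j (suc n) (suc m) = trans (sym (fromℚᵘ-toℚᵘ _))
    (fromℚᵘ-cong (ℚᵘ.≃-trans (toℚᵘ-homo-* (i / suc n) (j / suc m))
                             (ℚᵘ.*-cong (toℚᵘ-fromℚᵘ (mkℚᵘ i n)) (toℚᵘ-fromℚᵘ (mkℚᵘ j m)))))

  int-*-/ : ∀ i j n .{{_ : NonZero n}} → (i / 1) ℚ.* (j / n) ≡ (i ℤ.* j) / n
  int-*-/ i j n = trans (/-*-/ i j 1 n) (/-cong {i ℤ.* j} {{ℕ.m*n≢0 1 n}} refl (ℕ.*-identityˡ n))

  Σ₁-/ : ∀ m q .{{_ : NonZero q}} (h : ℕ → ℤ) → Σ₁ m (λ k → h k / q) ≡ ∑< m (λ k → h (suc k)) / q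
  Σ₁-/ zero    q h = sym (0/n≡0 q)
  Σ₁-/ (suc m) q h = begin
    Σ₁ m (λ k → h k / q) ℚ.+ h (suc m) / q   ≡⟨ cong (ℚ._+ h (suc m) / q) (Σ₁-/ m q h) ⟩
    s / q ℚ.+ h (suc m) / q                  ≡⟨ /-+-/ s (h (suc m)) q q ⟩
    _                                        ≡⟨ /-≡ (s ℤ.* + q ℤ.+ h (suc m) ℤ.* + q) (s ℤ.+ h (suc m)) (q ℕ.* q) q {{ℕ.m*n≢0 q q}} cross ⟩
    (s ℤ.+ h (suc m)) / q                    ∎
    where
    open ≡-Reasoning
    s = ∑< m (λ k → h (suc k))
    factor : ∀ a b c → (a ℤ.* c ℤ.+ b ℤ.* c) ℤ.* c ≡ (a ℤ.+ b) ℤ.* (c ℤ.* c)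
    factor = solve-∀
    cross : (s ℤ.* + q ℤ.+ h (suc m) ℤ.* + q) ℤ.* + q ≡ (s ℤ.+ h (suc m)) ℤ.* + (q ℕ.* q)
    cross = trans (factor s (h (suc m)) (+ q)) (cong ((s ℤ.+ h (suc m)) ℤ.*_) (sym (ℤ.pos-* q q)))

  Σ₁-cong : ∀ m {f g : ℕ → ℚ} → (∀ i → i < m → f (suc i) ≡ g (suc i)) → Σ₁ m f ≡ Σ₁ m g
  Σ₁-cong zero    _  = refl
  Σ₁-cong (suc m) eq = cong₂ ℚ._+_ (Σ₁-cong m (λ i i<m → eq i (ℕ.m<n⇒m<1+n i<m))) (eq m (ℕ.n<1+n m))

  Σ₁-+ : ∀ m f g → Σ₁ m (λ k → f k ℚ.+ g k) ≡ Σ₁ m f ℚ.+ Σ₁ m g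
  Σ₁-+ zero    f g = refl
  Σ₁-+ (suc m) f g = trans (cong (ℚ._+ (f (suc m) ℚ.+ g (suc m))) (Σ₁-+ m f g))
                           (swap (Σ₁ m f) (Σ₁ m g) (f (suc m)) (g (suc m)))
    where
    open +-*-Solver
    swap : ∀ a b c d → (a ℚ.+ b) ℚ.+ (c ℚ.+ d) ≡ (a ℚ.+ c) ℚ.+ (b ℚ.+ d)
    swap = solve 4 (λ a b c d → (a :+ b) :+ (c :+ d) := (a :+ c) :+ (b :+ d)) refl

  Σ₁-*ˡ : ∀ m c f → Σ₁ m (λ k → c ℚ.* f k) ≡ c ℚ.* Σ₁ m f
  Σ₁-*ˡ zero    c f = sym (*-zeroʳ c)
  Σ₁-*ˡ (suc m) c f =
    trans (cong (ℚ._+ c ℚ.* f (suc m)) (Σ₁-*ˡ m c f)) (sym (*-distribˡ-+ c (Σ₁ m f) (f (suc m))))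

  ↧ₙ-/-∣ : ∀ i d .{{_ : NonZero d}} → ↧ₙ (i / d) ∣ d
  ↧ₙ-/-∣ i d = subst (↧ₙ (i / d) ∣_) cancelled (m∣m*n (gcd ℤ.∣ i ∣ d))
    where
    cancelled : ↧ₙ (i / d) ℕ.* gcd ℤ.∣ i ∣ d ≡ d
    cancelled = ℤ.+-injective (trans (ℤ.pos-* (↧ₙ (i / d)) (gcd ℤ.∣ i ∣ d)) (↧-/ i d))

  IntegralAt : ℕ → ℚ → Set
  IntegralAt p x = Σ ℤ λ i → Σ ℕ λ d → Σ (NonZero d) λ d≢0 → (¬ p ∣ d) × x ≡ (i / d) {{d≢0}}

  module _ {p : ℕ} .{{_ : NonZero p}} (pr : Prime p) where

    integral-0 : IntegralAt p ℚ.0ℚ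
    integral-0 = + 0 , 1 , _ , (λ p∣1 → ℕ.nonTrivial⇒≢1 {{prime⇒nonTrivial pr}} (∣1⇒≡1 p∣1)) , refl

    integral-+ : ∀ {x y} → IntegralAt p x → IntegralAt p y → IntegralAt p (x ℚ.+ y)
    integral-+ (i , d , d≢0 , p∤d , refl) (j , e , e≢0 , p∤e , refl) =
      i ℤ.* + e ℤ.+ j ℤ.* + d , d ℕ.* e , ℕ.m*n≢0 d e {{d≢0}} {{e≢0}} , p∤de ,
      /-+-/ i j d e {{d≢0}} {{e≢0}}
      where
      p∤de : ¬ p ∣ d ℕ.* e
      p∤de p∣de with euclidsLemma d e pr p∣de
      ... | inj₁ p∣d = p∤d p∣d
      ... | inj₂ p∣e = p∤e p∣e

    integral-Σ₁ : ∀ m f → (∀ i → i < m → IntegralAt p (f (suc i))) → IntegralAt p (Σ₁ m f)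
    integral-Σ₁ zero    f _   = integral-0
    integral-Σ₁ (suc m) f int =
      integral-+ (integral-Σ₁ m f (λ i i<m → int i (ℕ.m<n⇒m<1+n i<m))) (int m (ℕ.n<1+n m))

    integral⇒coprime : ∀ {x} → IntegralAt p x → Coprime p (↧ₙ x)
    integral⇒coprime (i , d , d≢0 , p∤d , refl) {c} (c∣p , c∣x) with prime⇒irreducible pr c∣p
    ... | inj₁ c≡1 = c≡1
    ... | inj₂ refl = ⊥-elim (p∤d (∣-trans c∣x (↧ₙ-/-∣ i d {{d≢0}})))

    p*1/p≡1 : (+ p / 1) ℚ.* (+ 1 / p) ≡ ℚ.1ℚ
    p*1/p≡1 = trans (int-*-/ (+ p) (+ 1) p) (/-≡ (+ p ℤ.* + 1) (+ 1) p 1 (cross (+ p)))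
      where
      cross : ∀ x → x ℤ.* + 1 ℤ.* + 1 ≡ + 1 ℤ.* x
      cross = solve-∀

    ≡-mod-of-multiple : ∀ {a b w} → a ≡ b ℚ.+ (+ p / 1) ℚ.* w → IntegralAt p w → a ≡ b [modℚ p ]
    ≡-mod-of-multiple {a} {b} {w} refl int = subst (λ x → Coprime p (↧ₙ x)) (sym quotient) (integral⇒coprime int)
      where
      open ≡-Reasoning
      open +-*-Solver
      cancel : ∀ b P Q w → ((b ℚ.+ P ℚ.* w) ℚ.- b) ℚ.* Q ≡ (P ℚ.* Q) ℚ.* w
      cancel = solve 4 (λ b P Q w → ((b :+ P :* w) :- b) :* Q := (P :* Q) :* w) refl
      quotient : ((b ℚ.+ (+ p / 1) ℚ.* w) ℚ.- b) ℚ.* (+ 1 / p) ≡ w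
      quotient = begin
        ((b ℚ.+ (+ p / 1) ℚ.* w) ℚ.- b) ℚ.* (+ 1 / p) ≡⟨ cancel b (+ p / 1) (+ 1 / p) w ⟩
        ((+ p / 1) ℚ.* (+ 1 / p)) ℚ.* w               ≡⟨ cong (ℚ._* w) p*1/p≡1 ⟩
        ℚ.1ℚ ℚ.* w                                    ≡⟨ *-identityˡ w ⟩
        w                                             ∎

open import Data.Nat using (ℕ; suc)
open import Data.Nat.Primality using (Prime)
open Primes using (double)

module OddPrimeCongruence (m : ℕ) (pr : Prime (suc (double m))) where

  open import Defs using (Σ₁; summand; _≡_[modℚ_])
  open import Data.Nat as ℕ using (zero; _<_; s≤s; z≤n)
  import Data.Nat.Properties as ℕ
  open import Data.Nat.Combinatorics using (_C_)
  open import Data.Nat.DivMod using (m/n*n≡m)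
  open import Data.Integer as ℤ using (ℤ; +_; -_)
  import Data.Integer.Properties as ℤ
  open import Data.Integer.Tactic.RingSolver using (solve-∀)
  open import Data.Rational as ℚ using (ℚ; _/_)
  open import Data.Rational.Properties using (/-cong)
  open import Data.Product using (_,_)
  open import Relation.Binary.PropositionalEquality
  open ≡-Reasoning
  open Primes using (double; double≡*2; double-<; n≤double; prime∤)
  open BinomialsModPrime using (absorption; prime∣binomial-odd+1)
  open BinomialTransform using (∑<)
  open PowersOfOnePlusRootMinusThree using (a; a-odd)
  open Fractions

  p : ℕ
  p = suc (double m)

  evenTerm : ℕ → ℤ
  evenTerm k = + (p C double k) ℤ.* (- + 3) ℤ.^ k

  x : ℕ → ℚ
  x k = evenTerm k / p

  -- c_i = (C(p−1,2i+1) + 1)/p, a natural number for 2i + 1 < p.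
  c : ℕ → ℕ
  c i = (double m C suc (double i) ℕ.+ 1) ℕ./ p

  y : ℕ → ℚ
  y zero    = ℚ.0ℚ
  y (suc i) = ((- + 3) ℤ.^ suc i ℤ.* + c i) / suc i

  odd<p : ∀ {i} → i < m → suc (double i) < p
  odd<p i<m = ℕ.m<n⇒m<1+n (double-< i<m)

  y-integral : ∀ i → i < m → IntegralAt p (y (suc i))
  y-integral i i<m = (- + 3) ℤ.^ suc i ℤ.* + c i , suc i , _ , prime∤ pr (s≤s z≤n) (ℕ.≤-<-trans (s≤s (n≤double i)) (odd<p i<m)) , refl

  -- Clearing denominators in  E/K = −2·B·E/P + P·E·Q/K,  given the two facts
  -- 2K·B = P·B′ (absorption) and Q·P = B′ + 1 (B′ ≡ −1 mod P).
  cleared-identity : ∀ E K P B B′ Q → + 2 ℤ.* K ℤ.* B ≡ P ℤ.* B′ → Q ℤ.* P ≡ B′ ℤ.+ + 1 →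
    (- + 2 ℤ.* (B ℤ.* E) ℤ.* K ℤ.+ P ℤ.* (E ℤ.* Q) ℤ.* P) ℤ.* K ≡ E ℤ.* (P ℤ.* K)
  cleared-identity E K P B B′ Q absorb QP = begin
    (- + 2 ℤ.* (B ℤ.* E) ℤ.* K ℤ.+ P ℤ.* (E ℤ.* Q) ℤ.* P) ℤ.* K
      ≡⟨ expand E K P B Q ⟩
    K ℤ.* E ℤ.* (P ℤ.* (Q ℤ.* P) ℤ.- + 2 ℤ.* K ℤ.* B)
      ≡⟨ cong₂ (λ u v → K ℤ.* E ℤ.* (P ℤ.* u ℤ.- v)) QP absorb ⟩
    K ℤ.* E ℤ.* (P ℤ.* (B′ ℤ.+ + 1) ℤ.- P ℤ.* B′)
      ≡⟨ collapse E K P B′ ⟩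
    E ℤ.* (P ℤ.* K) ∎
    where
    expand : ∀ E K P B Q → (- + 2 ℤ.* (B ℤ.* E) ℤ.* K ℤ.+ P ℤ.* (E ℤ.* Q) ℤ.* P) ℤ.* K
                           ≡ K ℤ.* E ℤ.* (P ℤ.* (Q ℤ.* P) ℤ.- + 2 ℤ.* K ℤ.* B)
    expand = solve-∀
    collapse : ∀ E K P B′ → K ℤ.* E ℤ.* (P ℤ.* (B′ ℤ.+ + 1) ℤ.- P ℤ.* B′) ≡ E ℤ.* (P ℤ.* K)
    collapse = solve-∀

  term-split : ∀ i → i < m → summand (suc i) ≡ (- + 2 / 1) ℚ.* x (suc i) ℚ.+ (+ p / 1) ℚ.* y (suc i)
  term-split i i<m = sym (begin
    (- + 2 / 1) ℚ.* x k ℚ.+ (+ p / 1) ℚ.* y k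
      ≡⟨ cong₂ ℚ._+_ (int-*-/ (- + 2) (B ℤ.* E) p) (int-*-/ (+ p) (E ℤ.* + c i) k) ⟩
    (- + 2 ℤ.* (B ℤ.* E)) / p ℚ.+ (+ p ℤ.* (E ℤ.* + c i)) / k
      ≡⟨ /-+-/ (- + 2 ℤ.* (B ℤ.* E)) (+ p ℤ.* (E ℤ.* + c i)) p k ⟩
    (N / (p ℕ.* k)) {{ℕ.m*n≢0 p k}}
      ≡⟨ /-≡ N E (p ℕ.* k) k {{ℕ.m*n≢0 p k}} cross ⟩
    E / k ∎)
    where
    k = suc i
    E = (- + 3) ℤ.^ k
    B = + (p C double k)
    B′ = double m C suc (double i)
    absorb : + 2 ℤ.* + k ℤ.* B ≡ + p ℤ.* + B′
    absorb = begin
      + 2 ℤ.* + k ℤ.* B              ≡⟨ cong (ℤ._* B) (ℤ.pos-* 2 k) ⟨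
      + (2 ℕ.* k) ℤ.* B              ≡⟨ ℤ.pos-* (2 ℕ.* k) (p C double k) ⟨
      + (2 ℕ.* k ℕ.* (p C double k)) ≡⟨ cong (λ d → + (d ℕ.* (p C double k))) (trans (ℕ.*-comm 2 k) (sym (double≡*2 k))) ⟩
      + (double k ℕ.* (p C double k)) ≡⟨ cong +_ (absorption (double m) (suc (double i))) ⟩
      + (p ℕ.* B′)                   ≡⟨ ℤ.pos-* p B′ ⟩
      + p ℤ.* + B′                   ∎
    cp : + c i ℤ.* + p ≡ + B′ ℤ.+ + 1
    cp = trans (sym (ℤ.pos-* (c i) p))
               (trans (cong +_ (m/n*n≡m (prime∣binomial-odd+1 pr i (odd<p i<m)))) (ℤ.pos-+ B′ 1))
    N = - + 2 ℤ.* (B ℤ.* E) ℤ.* + k ℤ.+ + p ℤ.* (E ℤ.* + c i) ℤ.* + p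
    cross : N ℤ.* + k ≡ E ℤ.* + (p ℕ.* k)
    cross = trans (cleared-identity E (+ k) (+ p) B (+ B′) (+ c i) absorb cp) (cong (E ℤ.*_) (sym (ℤ.pos-* p k)))

  sum-x : Σ₁ m x ≡ (a p ℤ.- + 1) / p
  sum-x = trans (Σ₁-/ m p evenTerm) (/-cong (sym a-p-1) refl)
    where
    s = ∑< m (λ k → evenTerm (suc k))
    drop-one : ∀ s → + 1 ℤ.+ s ℤ.- + 1 ≡ s
    drop-one = solve-∀
    a-p-1 : a p ℤ.- + 1 ≡ s
    a-p-1 = trans (cong (ℤ._- + 1) (a-odd m)) (drop-one s)

  decomposition : Σ₁ m summand ≡ (- + 2 / 1) ℚ.* ((a p ℤ.- + 1) / p) ℚ.+ (+ p / 1) ℚ.* Σ₁ m y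
  decomposition = begin
    Σ₁ m summand
      ≡⟨ Σ₁-cong m term-split ⟩
    Σ₁ m (λ k → (- + 2 / 1) ℚ.* x k ℚ.+ (+ p / 1) ℚ.* y k)
      ≡⟨ Σ₁-+ m (λ k → (- + 2 / 1) ℚ.* x k) (λ k → (+ p / 1) ℚ.* y k) ⟩
    Σ₁ m (λ k → (- + 2 / 1) ℚ.* x k) ℚ.+ Σ₁ m (λ k → (+ p / 1) ℚ.* y k)
      ≡⟨ cong₂ ℚ._+_ (Σ₁-*ˡ m (- + 2 / 1) x) (Σ₁-*ˡ m (+ p / 1) y) ⟩
    (- + 2 / 1) ℚ.* Σ₁ m x ℚ.+ (+ p / 1) ℚ.* Σ₁ m y
      ≡⟨ cong (λ z → (- + 2 / 1) ℚ.* z ℚ.+ (+ p / 1) ℚ.* Σ₁ m y) sum-x ⟩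
    (- + 2 / 1) ℚ.* ((a p ℤ.- + 1) / p) ℚ.+ (+ p / 1) ℚ.* Σ₁ m y ∎

  congruence : Σ₁ m summand ≡ (- + 2 / 1) ℚ.* ((a p ℤ.- + 1) / p) [modℚ p ]
  congruence = ≡-mod-of-multiple pr decomposition (integral-Σ₁ pr m y y-integral)


open import Defs
open import Data.Nat using (ℕ; NonZero; _<_; _∸_; _/_)
open import Data.Nat.Primality using (Prime)
open import Data.Integer using (+_; -_)
open import Data.Rational using (ℚ; _*_)
open import Data.Rational using () renaming (_/_ to _/ℚ_)
open import Data.Product using (_,_)
open import Relation.Binary.PropositionalEquality using (refl; sym; subst)
open import Data.Integer as ℤ using ()
open import Data.Nat.Properties using (<⇒≤)
open Primes using (prime-odd; half-double)
open PowersOfOnePlusRootMinusThree using (a-prime)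

lemma3p4 : (p : ℕ) → .{{_ : NonZero p}} → Prime p → 3 < p →
    Σ₁ ((p ∸ 1) / 2) summand ≡ ((- (+ 2)) /ℚ 1) * fermatQuotient₂ p [modℚ p ]
lemma3p4 p pr 3<p with prime-odd pr (<⇒≤ 3<p)
... | m , refl =
  subst (λ k → Σ₁ k summand ≡ ((- (+ 2)) /ℚ 1) * fermatQuotient₂ p [modℚ p ]) (sym (half-double m))
    (subst (λ z → Σ₁ m summand ≡ ((- (+ 2)) /ℚ 1) * ((z ℤ.- + 1) /ℚ p) [modℚ p ]) (a-prime pr 3<p)
      (OddPrimeCongruence.congruence m pr))
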